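{- Let $G$ be a $d$-degenerate graph. Then $G$ is weighted $\frac{1}{2^{d+1}}$-flexibly $(d+2)$-choosable.
   Context: A graph is $d$-degenerate if its vertices admit an ordering $v_1,\dots,v_n$ such that each $v_i$ has at most $d$ neighbours $v_j$ with $j>i$. A graph $G$ is weighted $\epsilon$-flexibly $k$-choosable if for every list-assignment $L$ with $|L(v)|=k$ for all $v\in V(G)$ there is a probability distribution on proper $L$-colourings $c$ of $G$ (i.e. $c(v)\in L(v)$ for all $v$ and $c(u)\neq c(v)$ for adjacent $u,v$) such that $\mathbb{P}(c(v)=x)\ge\epsilon$ for every vertex $v$ and every $x\in L(v)$. -}

module Defs where

open import Data.Nat using (ℕ; zero; suc; _≟_) renaming (_≤_ to _≤ℕ_; _<_ to _<ℕ_)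
open import Data.Fin using (Fin) renaming (_<_ to _<F_)
open import Data.Fin.Permutation using (Permutation′; _⟨$⟩ʳ_)
open import Data.Bool using (Bool; true; false; if_then_else_)
open import Data.List using (List; []; _∷_; length; map; filter)
open import Data.List.Relation.Unary.All using (All)
open import Data.List.Relation.Unary.Unique.Propositional using (Unique)
open import Data.List.Membership.Propositional using (_∈_)
open import Data.Vec.Functional using () 
open import Data.Fin.Base using () 
open import Data.Product using (Σ; ∃; _×_; _,_; proj₁; proj₂)
open import Data.Rational using (ℚ; 0ℚ; 1ℚ; ½; _+_; _*_; _≤_)
open import Relation.Binary.PropositionalEquality using (_≡_; _≢_)
open import Relation.Nullary.Decidable using (⌊_⌋)
import Data.Fin as F
open import Data.List using (allFin)

record Graph : Set where
  field
    n      : ℕ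
    adj    : Fin n → Fin n → Bool
    sym    : ∀ u v → adj u v ≡ adj v u
    irrefl : ∀ v → adj v v ≡ false
open Graph public

countTrue : List Bool → ℕ
countTrue []          = 0
countTrue (true ∷ bs)  = suc (countTrue bs)
countTrue (false ∷ bs) = countTrue bs

Degenerate : ℕ → Graph → Set
Degenerate d G =
  Σ (Permutation′ (n G)) λ σ →
    ∀ (i : Fin (n G)) →
      countTrue (map (λ j → if ⌊ F._<?_ i j ⌋ then adj G (σ ⟨$⟩ʳ i) (σ ⟨$⟩ʳ j) else false)
                     (allFin (n G)))
      ≤ℕ d

-- A list-assignment with lists of size k (colours are natural numbers;
-- a list of k distinct colours represents a k-element set).
ListAssignment : ℕ → Graph → Set
ListAssignment k G =
  Σ (Fin (n G) → List ℕ) λ L → ∀ v → Unique (L v) × length (L v) ≡ k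

IsProperLColouring : (G : Graph) → (Fin (n G) → List ℕ) → (Fin (n G) → ℕ) → Set
IsProperLColouring G L c =
  (∀ v → c v ∈ L v) × (∀ u v → adj G u v ≡ true → c u ≢ c v)

ProperLColouring : (G : Graph) → (Fin (n G) → List ℕ) → Set
ProperLColouring G L = Σ (Fin (n G) → ℕ) (IsProperLColouring G L)

-- A finitely supported probability distribution on proper L-colourings:
-- a list of (weight, colouring) pairs, weights non-negative and summing to 1.
Distribution : (G : Graph) → (Fin (n G) → List ℕ) → Set
Distribution G L = List (ℚ × ProperLColouring G L)

totalWeight : {A : Set} → List (ℚ × A) → ℚ
totalWeight []             = 0ℚ
totalWeight ((p , _) ∷ ps) = p + totalWeight ps

IsProbDist : (G : Graph) (L : Fin (n G) → List ℕ) → Distribution G L → Set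
IsProbDist G L ps = All (λ pc → 0ℚ ≤ proj₁ pc) ps × totalWeight ps ≡ 1ℚ

prob : (G : Graph) (L : Fin (n G) → List ℕ) → Distribution G L → Fin (n G) → ℕ → ℚ
prob G L []             v x = 0ℚ
prob G L ((p , c) ∷ ps) v x =
  (if ⌊ proj₁ c v ≟ x ⌋ then p else 0ℚ) + prob G L ps v x

WeightedFlexiblyChoosable : ℚ → ℕ → Graph → Set
WeightedFlexiblyChoosable ε k G =
  ∀ (LA : ListAssignment k G) →
    Σ (Distribution G (proj₁ LA)) λ D →
      IsProbDist G (proj₁ LA) D × (∀ v x → x ∈ proj₁ LA v → ε ≤ prob G (proj₁ LA) D v x)

halfPow : ℕ → ℚ
halfPow zero    = 1ℚ
halfPow (suc k) = ½ * halfPow k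

{-# OPTIONS --safe #-}
-- Colour the vertices greedily, later ones in the degeneracy order first, so that each vertex has
-- at most d earlier-coloured neighbours and hence at least two available colours. Every vertex reads
-- d + 1 fair bits, picks an ordered pair of distinct available colours, and its last bit selects one
-- of the two. To reach colour x at v, keep a list of candidates for v: it starts as L(v), and each
-- earlier neighbour u, offering (a, b), shrinks it so that u's colour is no longer a candidate while
-- one of u's two choices keeps x. Fixing one bit per earlier neighbour thus keeps x a candidate that
-- no neighbour took; at most d + 2 − k candidates survive the k neighbours, v spends d − k bits
-- cutting them down to two, one of which is x, and its last bit picks x. Each of these d + 1 bits is
-- fixed knowing only the bits before it, so c(v) = x has probability at least 2^-(d+1).
module Submission where

open import Data.Bool using (Bool; true; false; if_then_else_)
open import Data.Bool.Properties using () renaming (_≟_ to _≟ᴮ_)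
open import Data.Fin as F using (Fin; toℕ; fromℕ<; opposite)
open import Data.Fin.Permutation using (_⟨$⟩ʳ_; _⟨$⟩ˡ_; inverseʳ)
open import Data.Fin.Properties using (toℕ<n; toℕ-injective; fromℕ<-toℕ; toℕ-fromℕ<; opposite-prop; opposite-involutive)
open import Data.List using (List; []; _∷_; [_]; _++_; length; map; filter; foldl; take; drop; upTo; allFin)
open import Data.List.Membership.Propositional using (_∈_; _∉_)
open import Data.List.Membership.Propositional.Properties
  using (∈-filter⁺; ∈-filter⁻; ∈-++⁺ˡ; ∈-++⁺ʳ; ∈-++⁻; ∈-upTo⁺; ∈-upTo⁻; ∈-map⁺; ∈-map⁻; ∈-allFin)
open import Data.List.Properties
  using (++-assoc; ++-identityʳ; filter-notAll; filter-accept; filter-reject; filter-++; length-filter; length-++; length-map;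
         map-cong-local; map-++; foldl-++; upTo-∷ʳ)
open import Data.List.Relation.Binary.Subset.Propositional using (_⊆_)
open import Data.List.Relation.Unary.All as All using (All; []; _∷_)
open import Data.List.Relation.Unary.All.Properties using (++⁺)
open import Data.List.Relation.Unary.AllPairs using (_∷_)
open import Data.List.Relation.Unary.Any as Any using (here; there)
open import Data.List.Relation.Unary.Unique.Propositional using (Unique)
open import Data.List.Relation.Unary.Unique.Propositional.Properties using (filter⁺; upTo⁺)
open import Data.Nat using (ℕ; zero; suc; _+_; _*_; _∸_; _≤_; _<_; z≤n; s≤s; _≟_; _<?_)
open import Data.Nat.Properties
  using (≤-trans; ≤-refl; ≤-reflexive; ≤-pred; <-trans; <-cmp; <⇒≢; ≤⇒≯; 1+n≰n; n≤1+n; n<1+n; m<n⇒m<1+n; m<1+n⇒m≤n;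
         m<1+n⇒m<n∨m≡n; m≤n⇒m<n∨m≡n; m≤m+n; m<m+n; +-comm; +-suc; +-identityʳ; +-cancelʳ-≤; +-monoʳ-≤;
         +-∸-assoc; m+n∸m≡n; m+[n∸m]≡n; ∸-monoʳ-<; module ≤-Reasoning)
open import Data.Product using (∃-syntax; _×_; _,_; proj₁; proj₂; map₁)
open import Data.Rational using (ℚ; 0ℚ; 1ℚ; ½) renaming (_+_ to _+ℚ_; _*_ to _*ℚ_; _≤_ to _≤ℚ_)
import Data.Rational.Properties as ℚ
open import Data.Sum using (_⊎_; inj₁; inj₂; [_,_]′)
open import Data.Unit using (⊤; tt)
open import Function using (_∘_)
open import Relation.Binary.Definitions using (Decidable; DecidableEquality; tri<; tri≈; tri>)
open import Relation.Binary.PropositionalEquality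
  using (_≡_; _≢_; refl; sym; trans; cong; cong₂; subst; subst₂; module ≡-Reasoning)
open import Relation.Nullary using (¬_; yes; no; ¬?; contradiction)
open import Relation.Nullary.Decidable using (⌊_⌋)
import Relation.Unary

open import Defs hiding (sym)

module _ {A : Set} (_≟ᴬ_ : DecidableEquality A) where

  deleteAll : A → List A → List A
  deleteAll y = filter (λ z → ¬? (z ≟ᴬ y))

  ∈-deleteAll⁺ : ∀ {x y T} → x ∈ T → x ≢ y → x ∈ deleteAll y T
  ∈-deleteAll⁺ = ∈-filter⁺ _

  ∈-deleteAll⁻ : ∀ {x y} T → x ∈ deleteAll y T → x ∈ T × x ≢ y
  ∈-deleteAll⁻ {y = y} T = ∈-filter⁻ (λ z → ¬? (z ≟ᴬ y)) {xs = T}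

  length-deleteAll< : ∀ {y} T → y ∈ T → length (deleteAll y T) < length T
  length-deleteAll< T y∈T = filter-notAll _ T (Any.map (λ y≡z z≢y → z≢y (sym y≡z)) y∈T)

  unique-⊆⇒length≤ : ∀ {xs ys : List A} → Unique xs → xs ⊆ ys → length xs ≤ length ys
  unique-⊆⇒length≤ {[]}     _            _     = z≤n
  unique-⊆⇒length≤ {x ∷ xs} {ys} (x∉xs ∷ u) xs⊆ys = begin
    suc (length xs)               ≤⟨ s≤s (unique-⊆⇒length≤ u xs⊆ys-x) ⟩
    suc (length (deleteAll x ys)) ≤⟨ length-deleteAll< ys (xs⊆ys (here refl)) ⟩
    length ys                     ∎
    where
    open ≤-Reasoning
    xs⊆ys-x : xs ⊆ deleteAll x ys
    xs⊆ys-x z∈xs = ∈-deleteAll⁺ (xs⊆ys (there z∈xs)) (λ z≡x → All.lookup x∉xs z∈xs (sym z≡x))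

take-length-++ : ∀ {A : Set} (xs ys : List A) → take (length xs) (xs ++ ys) ≡ xs
take-length-++ []       ys = refl
take-length-++ (x ∷ xs) ys = cong (x ∷_) (take-length-++ xs ys)

drop-length-++ : ∀ {A : Set} (xs ys : List A) → drop (length xs) (xs ++ ys) ≡ ys
drop-length-++ []       ys = refl
drop-length-++ (x ∷ xs) ys = drop-length-++ xs ys

filter-upTo-< : ∀ {P : ℕ → Set} (P? : Relation.Unary.Decidable P) t → All (_< t) (filter P? (upTo t))
filter-upTo-< P? t = All.tabulate λ q∈ → ∈-upTo⁻ (proj₁ (∈-filter⁻ P? {xs = upTo t} q∈))

countTrue-map : ∀ {A : Set} (g : A → Bool) xs → countTrue (map g xs) ≡ length (filter (λ a → g a ≟ᴮ true) xs)
countTrue-map g []       = refl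
countTrue-map g (a ∷ xs) with g a
... | true  = cong suc (countTrue-map g xs)
... | false = countTrue-map g xs

-- Candidate lists

open import Data.List.Membership.DecPropositional _≟_ using (_∈?_; _∉?_)

record Choice : Set where
  constructor choice
  field
    left right : ℕ
    takesRight : Bool
open Choice

colour : Choice → ℕ
colour (choice a b false) = a
colour (choice a b true)  = b

colour-offered : ∀ c → colour c ≡ left c ⊎ colour c ≡ right c
colour-offered (choice a b false) = inj₁ refl
colour-offered (choice a b true)  = inj₂ refl

shrink : Bool → List ℕ → List ℕ
shrink false = take 1
shrink true  = drop 1

shrink-⊆ : ∀ p {T} → shrink p T ⊆ T
shrink-⊆ false {y ∷ T} (here refl) = here refl
shrink-⊆ true  {y ∷ T} x∈T         = there x∈T

shrink-length : ∀ p {r} (T : List ℕ) → length T ≤ 2 + r → length (shrink p T) ≤ suc r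
shrink-length false []      _            = z≤n
shrink-length false (y ∷ T) _            = s≤s z≤n
shrink-length true  []      _            = z≤n
shrink-length true  (y ∷ T) (s≤s |T|≤r) = |T|≤r

shrink-covers : ∀ {x T} → x ∈ T → ∃[ p ] x ∈ shrink p T
shrink-covers (here refl) = false , here refl
shrink-covers (there x∈T) = true , x∈T

cut : ℕ → List ℕ → ℕ → List ℕ
cut y T c with c ≟ y
... | yes _ = deleteAll _≟_ y T
... | no  _ = [ y ]

cut-excludes : ∀ y T c → c ∉ cut y T c
cut-excludes y T c c∈cut with c ≟ y
cut-excludes y T c c∈cut      | yes c≡y = proj₂ (∈-deleteAll⁻ _≟_ T c∈cut) c≡y
cut-excludes y T c (here c≡y) | no  c≢y = c≢y c≡y

cut-length : ∀ {y r} T c → y ∈ T → length T ≤ 2 + r → length (cut y T c) ≤ suc r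
cut-length {y} T c y∈T |T|≤2+r with c ≟ y
... | yes _ = ≤-pred (≤-trans (length-deleteAll< _≟_ T y∈T) |T|≤2+r)
... | no  _ = s≤s z≤n

cut-deletes : ∀ {x y T} → x ∈ T → x ≢ y → x ∈ cut y T y
cut-deletes {y = y} x∈T x≢y with y ≟ y
... | yes _   = ∈-deleteAll⁺ _≟_ x∈T x≢y
... | no  y≢y = contradiction refl y≢y

cut-isolates : ∀ {y c} T → c ≢ y → y ∈ cut y T c
cut-isolates {y} {c} T c≢y with c ≟ y
... | yes c≡y = contradiction c≡y c≢y
... | no  _   = here refl

narrow : List ℕ → Choice → List ℕ
narrow T c with left c ∈? T | right c ∈? T
... | yes _ | _     = cut (left c) T (colour c)
... | no  _ | yes _ = cut (right c) T (colour c)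
... | no  _ | no  _ = shrink (takesRight c) T

narrow-excludes : ∀ T c → colour c ∉ narrow T c
narrow-excludes T c with left c ∈? T | right c ∈? T
... | yes _   | _       = cut-excludes (left c) T (colour c)
... | no  _   | yes _   = cut-excludes (right c) T (colour c)
... | no  a∉T | no  b∉T = λ c∈ → let c∈T = shrink-⊆ (takesRight c) c∈ in
                            [ (λ c≡a → a∉T (subst (_∈ T) c≡a c∈T))
                            , (λ c≡b → b∉T (subst (_∈ T) c≡b c∈T)) ]′ (colour-offered c)

narrow-length : ∀ {r} T c → length T ≤ 2 + r → length (narrow T c) ≤ suc r
narrow-length T c |T|≤2+r with left c ∈? T | right c ∈? T
... | yes a∈T | _       = cut-length T (colour c) a∈T |T|≤2+r
... | no  _   | yes b∈T = cut-length T (colour c) b∈T |T|≤2+r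
... | no  _   | no  _   = shrink-length (takesRight c) T |T|≤2+r

narrow-covers : ∀ {x a b T} → x ∈ T → a ≢ b → ∃[ p ] x ∈ narrow T (choice a b p)
narrow-covers {x} {a} {b} {T} x∈T a≢b with a ∈? T | b ∈? T | x ≟ a | x ≟ b
... | yes _ | _     | yes x≡a | _       = true  , subst (_∈ cut a T b) (sym x≡a) (cut-isolates T (a≢b ∘ sym))
... | yes _ | _     | no  x≢a | _       = false , cut-deletes x∈T x≢a
... | no  _ | yes _ | _       | yes x≡b = false , subst (_∈ cut b T a) (sym x≡b) (cut-isolates T a≢b)
... | no  _ | yes _ | _       | no  x≢b = true  , cut-deletes x∈T x≢b
... | no  _ | no  _ | _       | _       = shrink-covers x∈T

narrowAll : List ℕ → List Choice → List ℕ
narrowAll = foldl narrow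

narrowAll-length : ∀ {r} T cs → length T ≤ 2 + (length cs + r) → length (narrowAll T cs) ≤ 2 + r
narrowAll-length T []       |T|≤ = |T|≤
narrowAll-length T (c ∷ cs) |T|≤ = narrowAll-length (narrow T c) cs (narrow-length T c |T|≤)

shrinkAll : List Bool → List ℕ → List ℕ
shrinkAll []       T = T
shrinkAll (p ∷ ps) T = shrinkAll ps (shrink p T)

shrinkAll-length : ∀ ps T → length T ≤ 2 + length ps → length (shrinkAll ps T) ≤ 2
shrinkAll-length []       T |T|≤ = |T|≤
shrinkAll-length (p ∷ ps) T |T|≤ = shrinkAll-length ps (shrink p T) (shrink-length p T |T|≤)

shrinkAll-covers : ∀ {x T} j → x ∈ T → ∃[ ps ] length ps ≡ j × x ∈ shrinkAll ps T
shrinkAll-covers zero x∈T = [] , refl , x∈T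
shrinkAll-covers {T = y ∷ T} (suc j) (here refl) with shrinkAll-covers j (here refl)
... | ps , refl , x∈ = false ∷ ps , refl , x∈
shrinkAll-covers (suc j) (there x∈T) with shrinkAll-covers j x∈T
... | ps , refl , x∈ = true ∷ ps , refl , x∈

-- Junk value y when every entry equals y.
firstOther : ℕ → List ℕ → ℕ
firstOther y []       = y
firstOther y (z ∷ zs) with z ≟ y
... | yes _ = firstOther y zs
... | no  _ = z

firstOther-spec : ∀ {y z zs} → z ∈ zs → z ≢ y → firstOther y zs ∈ zs × firstOther y zs ≢ y
firstOther-spec {y} {zs = w ∷ zs} z∈ z≢y with w ≟ y
firstOther-spec (here refl)  z≢y | yes w≡y = contradiction w≡y z≢y
firstOther-spec (there z∈zs) z≢y | yes _   = map₁ there (firstOther-spec z∈zs z≢y)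
... | no w≢y = here refl , w≢y

TwoDistinctIn : List ℕ → ℕ × ℕ → Set
TwoDistinctIn A ab = proj₁ ab ∈ A × proj₂ ab ∈ A × proj₁ ab ≢ proj₂ ab

offer : List ℕ → ℕ × ℕ
offer []       = 0 , 0
offer (y ∷ ys) = y , firstOther y ys

offer-spec : ∀ {z₁ z₂ W} → z₁ ∈ W → z₂ ∈ W → z₁ ≢ z₂ → TwoDistinctIn W (offer W)
offer-spec {z₁} {z₂} {y ∷ ys} z₁∈W z₂∈W z₁≢z₂ = here refl , there (proj₁ other) , proj₂ other ∘ sym
  where
  other : firstOther y ys ∈ ys × firstOther y ys ≢ y
  other with z₁ ≟ y
  ... | yes z₁≡y = let z₂≢y = λ z₂≡y → z₁≢z₂ (trans z₁≡y (sym z₂≡y))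
                   in  firstOther-spec (Any.tail z₂≢y z₂∈W) z₂≢y
  ... | no  z₁≢y = firstOther-spec (Any.tail z₁≢y z₁∈W) z₁≢y

offer-⊆ : ∀ {T A} → T ⊆ A → Unique A → 2 ≤ length A → TwoDistinctIn A (offer (T ++ A))
offer-⊆ {T} {z₁ ∷ z₂ ∷ _} T⊆A ((z₁≢z₂ ∷ _) ∷ _) _ =
  let (a∈ , b∈ , a≢b) = offer-spec (∈-++⁺ʳ T (here refl)) (∈-++⁺ʳ T (there (here refl))) z₁≢z₂
  in  T++A⊆A a∈ , T++A⊆A b∈ , a≢b
  where
  T++A⊆A : T ++ _ ⊆ _
  T++A⊆A y∈ = [ T⊆A , (λ y∈A → y∈A) ]′ (∈-++⁻ T y∈)
offer-⊆ {A = _ ∷ []} _ _ (s≤s ())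

offer-covers : ∀ {x T} A → x ∈ T → length T ≤ 2 → x ≡ proj₁ (offer (T ++ A)) ⊎ x ≡ proj₂ (offer (T ++ A))
offer-covers A (here x≡y) _ = inj₁ x≡y
offer-covers {T = y ∷ z ∷ []} A (there (here x≡z)) _ with z ≟ y
... | yes z≡y = inj₁ (trans x≡z z≡y)
... | no  _   = inj₂ x≡z
offer-covers {T = y ∷ z ∷ w ∷ _} A _ (s≤s (s≤s ()))

-- Forcing events on random bit strings

-- Forced P m c: a player who sees m fair bits one at a time and may fix c of them, each knowing
-- only the bits before it, can make the whole string satisfy P.
data Forced : (List Bool → Set) → ℕ → ℕ → Set₁ where
  done   : ∀ {P} → P [] → Forced P 0 0
  free   : ∀ {P m c} → (∀ b → Forced (P ∘ (b ∷_)) m c) → Forced P (suc m) c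
  choose : ∀ {P m c} b → Forced (P ∘ (b ∷_)) m c → Forced P (suc m) (suc c)

Forced-map : ∀ {P Q : List Bool → Set} {m c} → (∀ {ω} → P ω → Q ω) → Forced P m c → Forced Q m c
Forced-map P⇒Q (done p)     = done (P⇒Q p)
Forced-map P⇒Q (free h)     = free λ b → Forced-map P⇒Q (h b)
Forced-map P⇒Q (choose b h) = choose b (Forced-map P⇒Q h)

Forced-always : ∀ {P : List Bool → Set} m → (∀ {ω} → P ω) → Forced P m 0
Forced-always zero    p = done p
Forced-always (suc m) p = free λ _ → Forced-always m p

Forced-exactly : ∀ g → Forced (_≡ g) (length g) (length g)
Forced-exactly []      = done refl
Forced-exactly (b ∷ g) = choose b (Forced-map (cong (b ∷_)) (Forced-exactly g))

Forced-bind : ∀ {P Q : List Bool → Set} {m₁ m₂ c₁ c₂} → Forced Q m₁ c₁ →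
              (∀ {f} → length f ≡ m₁ → Q f → Forced (P ∘ (f ++_)) m₂ c₂) → Forced P (m₁ + m₂) (c₁ + c₂)
Forced-bind (done q)     k = k refl q
Forced-bind (free h)     k = free λ b → Forced-bind (h b) λ |f| → k (cong suc |f|)
Forced-bind (choose b h) k = choose b (Forced-bind h λ |f| → k (cong suc |f|))

Forced-free : ∀ {P : List Bool → Set} {m c} j → (∀ {f} → length f ≡ j → Forced (P ∘ (f ++_)) m c) → Forced P (j + m) c
Forced-free j k = Forced-bind (Forced-always {P = λ _ → ⊤} j tt) (λ |f| _ → k |f|)

-- The uniform distribution on bit strings

halve : {A : Set} → List (ℚ × A) → List (ℚ × A)
halve = map (map₁ (½ *ℚ_))

uniform : {A : Set} → ℕ → (List Bool → A) → List (ℚ × A)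
uniform zero    f = [ 1ℚ , f [] ]
uniform (suc m) f = halve (uniform m (f ∘ (false ∷_))) ++ halve (uniform m (f ∘ (true ∷_)))

½*-nonNeg : ∀ {p} → 0ℚ ≤ℚ p → 0ℚ ≤ℚ ½ *ℚ p
½*-nonNeg 0≤p = ℚ.≤-trans (ℚ.≤-reflexive (sym (ℚ.*-zeroʳ ½))) (ℚ.*-monoˡ-≤-nonNeg ½ 0≤p)

½*-+-½* : ∀ p → ½ *ℚ p +ℚ ½ *ℚ p ≡ p
½*-+-½* p = trans (sym (ℚ.*-distribʳ-+ p ½ ½)) (ℚ.*-identityˡ p)

totalWeight-++ : {A : Set} (xs ys : List (ℚ × A)) → totalWeight (xs ++ ys) ≡ totalWeight xs +ℚ totalWeight ys
totalWeight-++ []             ys = sym (ℚ.+-identityˡ _)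
totalWeight-++ ((p , _) ∷ xs) ys = trans (cong (p +ℚ_) (totalWeight-++ xs ys)) (sym (ℚ.+-assoc p _ _))

totalWeight-halve : {A : Set} (xs : List (ℚ × A)) → totalWeight (halve xs) ≡ ½ *ℚ totalWeight xs
totalWeight-halve []             = sym (ℚ.*-zeroʳ ½)
totalWeight-halve ((p , _) ∷ xs) = trans (cong (½ *ℚ p +ℚ_) (totalWeight-halve xs)) (sym (ℚ.*-distribˡ-+ ½ p _))

totalWeight-uniform : {A : Set} (m : ℕ) (f : List Bool → A) → totalWeight (uniform m f) ≡ 1ℚ
totalWeight-uniform zero    f = ℚ.+-identityʳ 1ℚ
totalWeight-uniform (suc m) f = begin
  totalWeight (halve U₀ ++ halve U₁)               ≡⟨ totalWeight-++ (halve U₀) (halve U₁) ⟩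
  totalWeight (halve U₀) +ℚ totalWeight (halve U₁) ≡⟨ cong₂ _+ℚ_ (totalWeight-halve U₀) (totalWeight-halve U₁) ⟩
  ½ *ℚ totalWeight U₀ +ℚ ½ *ℚ totalWeight U₁       ≡⟨ cong₂ (λ p q → ½ *ℚ p +ℚ ½ *ℚ q)
                                                              (totalWeight-uniform m _) (totalWeight-uniform m _) ⟩
  ½ *ℚ 1ℚ +ℚ ½ *ℚ 1ℚ                               ≡⟨ ½*-+-½* 1ℚ ⟩
  1ℚ                                               ∎
  where
  open ≡-Reasoning
  U₀ = uniform m (f ∘ (false ∷_))
  U₁ = uniform m (f ∘ (true ∷_))

uniform-nonNeg : {A : Set} (m : ℕ) (f : List Bool → A) → All (λ pc → 0ℚ ≤ℚ proj₁ pc) (uniform m f)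
uniform-nonNeg zero    f = ℚ.nonNegative⁻¹ 1ℚ ∷ []
uniform-nonNeg (suc m) f = ++⁺ (halve-nonNeg (uniform-nonNeg m _)) (halve-nonNeg (uniform-nonNeg m _))
  where
  halve-nonNeg : ∀ {xs} → All (λ pc → 0ℚ ≤ℚ proj₁ pc) xs → All (λ pc → 0ℚ ≤ℚ proj₁ pc) (halve xs)
  halve-nonNeg []         = []
  halve-nonNeg (0≤p ∷ ps) = ½*-nonNeg 0≤p ∷ halve-nonNeg ps

module _ (G : Graph) (L : Fin (n G) → List ℕ) where

  prob-++ : ∀ (xs ys : Distribution G L) v x → prob G L (xs ++ ys) v x ≡ prob G L xs v x +ℚ prob G L ys v x
  prob-++ []             ys v x = sym (ℚ.+-identityˡ _)
  prob-++ ((p , c) ∷ xs) ys v x =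
    trans (cong (hit +ℚ_) (prob-++ xs ys v x)) (sym (ℚ.+-assoc hit (prob G L xs v x) (prob G L ys v x)))
    where hit = if ⌊ proj₁ c v ≟ x ⌋ then p else 0ℚ

  prob-halve : ∀ (xs : Distribution G L) v x → prob G L (halve xs) v x ≡ ½ *ℚ prob G L xs v x
  prob-halve []             v x = sym (ℚ.*-zeroʳ ½)
  prob-halve ((p , c) ∷ xs) v x with ⌊ proj₁ c v ≟ x ⌋
  ... | true  = trans (cong (½ *ℚ p +ℚ_) (prob-halve xs v x)) (sym (ℚ.*-distribˡ-+ ½ p _))
  ... | false = trans (cong (0ℚ +ℚ_) (prob-halve xs v x))
                      (trans (ℚ.+-identityˡ (½ *ℚ prob G L xs v x)) (cong (½ *ℚ_) (sym (ℚ.+-identityˡ (prob G L xs v x)))))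

  prob-nonNeg : ∀ {xs : Distribution G L} → All (λ pc → 0ℚ ≤ℚ proj₁ pc) xs → ∀ v x → 0ℚ ≤ℚ prob G L xs v x
  prob-nonNeg []                           v x = ℚ.≤-refl
  prob-nonNeg {(p , c) ∷ _} (0≤p ∷ 0≤ps) v x with ⌊ proj₁ c v ≟ x ⌋
  ... | true  = ℚ.≤-trans (ℚ.≤-reflexive (sym (ℚ.+-identityʳ 0ℚ))) (ℚ.+-mono-≤ 0≤p (prob-nonNeg 0≤ps v x))
  ... | false = ℚ.≤-trans (prob-nonNeg 0≤ps v x) (ℚ.≤-reflexive (sym (ℚ.+-identityˡ _)))

  prob-uniform-suc : ∀ m (f : List Bool → ProperLColouring G L) v x →
    prob G L (uniform (suc m) f) v x ≡
    ½ *ℚ prob G L (uniform m (f ∘ (false ∷_))) v x +ℚ ½ *ℚ prob G L (uniform m (f ∘ (true ∷_))) v x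
  prob-uniform-suc m f v x =
    trans (prob-++ (halve (uniform m _)) _ v x) (cong₂ _+ℚ_ (prob-halve (uniform m _) v x) (prob-halve (uniform m _) v x))

  forced⇒prob : ∀ {m c} (f : List Bool → ProperLColouring G L) v x →
                Forced (λ ω → proj₁ (f ω) v ≡ x) m c → halfPow c ≤ℚ prob G L (uniform m f) v x
  forced⇒prob f v x (done fv≡x) with proj₁ (f []) v ≟ x
  ... | yes _    = ℚ.≤-reflexive (sym (ℚ.+-identityʳ 1ℚ))
  ... | no  fv≢x = contradiction fv≡x fv≢x
  forced⇒prob {suc m} {c} f v x (free h) = begin
    halfPow c                        ≡⟨ sym (½*-+-½* (halfPow c)) ⟩
    ½ *ℚ halfPow c +ℚ ½ *ℚ halfPow c ≤⟨ ℚ.+-mono-≤ (½*-mono (forced⇒prob _ v x (h false)))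
                                                    (½*-mono (forced⇒prob _ v x (h true))) ⟩
    ½ *ℚ p false +ℚ ½ *ℚ p true      ≡⟨ sym (prob-uniform-suc m f v x) ⟩
    prob G L (uniform (suc m) f) v x ∎
    where
    open ℚ.≤-Reasoning
    p : Bool → ℚ
    p b = prob G L (uniform m (f ∘ (b ∷_))) v x
    ½*-mono : ∀ {p q} → p ≤ℚ q → ½ *ℚ p ≤ℚ ½ *ℚ q
    ½*-mono = ℚ.*-monoˡ-≤-nonNeg ½
  forced⇒prob {suc m} {suc c} f v x (choose b h) = begin
    ½ *ℚ halfPow c                   ≤⟨ ℚ.*-monoˡ-≤-nonNeg ½ (forced⇒prob _ v x h) ⟩
    ½ *ℚ p b                         ≤⟨ half≤sum b ⟩
    ½ *ℚ p false +ℚ ½ *ℚ p true      ≡⟨ sym (prob-uniform-suc m f v x) ⟩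
    prob G L (uniform (suc m) f) v x ∎
    where
    open ℚ.≤-Reasoning
    p : Bool → ℚ
    p b = prob G L (uniform m (f ∘ (b ∷_))) v x
    0≤½p : ∀ b → 0ℚ ≤ℚ ½ *ℚ p b
    0≤½p b = ½*-nonNeg (prob-nonNeg (uniform-nonNeg m _) v x)
    half≤sum : ∀ b → ½ *ℚ p b ≤ℚ ½ *ℚ p false +ℚ ½ *ℚ p true
    half≤sum false = ℚ.≤-trans (ℚ.≤-reflexive (sym (ℚ.+-identityʳ _))) (ℚ.+-monoʳ-≤ (½ *ℚ p false) (0≤½p true))
    half≤sum true  = ℚ.≤-trans (ℚ.≤-reflexive (sym (ℚ.+-identityˡ _))) (ℚ.+-monoˡ-≤ (½ *ℚ p true) (0≤½p false))

-- Greedy colouring of times 0, 1, …, n − 1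

firstBit : List Bool → Bool
firstBit []      = false
firstBit (b ∷ _) = b

module GreedyColouring
  (d n : ℕ) {_∼_ : ℕ → ℕ → Set} (_∼?_ : Decidable _∼_) (L : ℕ → List ℕ)
  (L-unique : ∀ {t} → t < n → Unique (L t))
  (L-length : ∀ {t} → t < n → length (L t) ≡ 2 + d)
  (degenerate : ∀ {t} → t < n → length (filter (t ∼?_) (upTo t)) ≤ d)
  where

  State : Set
  State = ℕ → Choice

  blank : State
  blank _ = choice 0 0 false

  assign : State → ℕ → Choice → State
  assign s t c q with q ≟ t
  ... | yes _ = c
  ... | no  _ = s q

  earlier : ℕ → List ℕ
  earlier t = filter (t ∼?_) (upTo t)

  used : ℕ → State → List ℕ
  used t s = map (colour ∘ s) (earlier t)

  available : ℕ → State → List ℕ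
  available t s = filter (_∉? used t s) (L t)

  candidates : ℕ → State → List ℕ
  candidates t s = narrowAll (L t) (map s (earlier t))

  finalists : ℕ → State → List Bool → List ℕ
  finalists t s nav = filter (_∈? available t s) (shrinkAll nav (candidates t s))

  offerFor : ℕ → State → List Bool → ℕ × ℕ
  offerFor t s nav = offer (finalists t s nav ++ available t s)

  decideWith : ℕ → State → List Bool → Bool → Choice
  decideWith t s nav p = choice (proj₁ (offerFor t s nav)) (proj₂ (offerFor t s nav)) p

  -- The block of time t has d + 1 bits: k = length (earlier t) ignored ones, d − k steering
  -- shrinkAll, and the choice bit.
  decide : ℕ → State → List Bool → Choice
  decide t s blk = decideWith t s (drop (length (earlier t)) (take d blk)) (firstBit (drop d blk))

  run : ℕ → ℕ → State → List Bool → State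
  run zero    t s ω = s
  run (suc r) t s ω = run r (suc t) (assign s t (decide t s (take (suc d) ω))) (drop (suc d) ω)

  run-step : ∀ {r t s blk} ω → length blk ≡ suc d → run (suc r) t s (blk ++ ω) ≡ run r (suc t) (assign s t (decide t s blk)) ω
  run-step {r} {t} {s} {blk} ω |blk| =
    cong₂ (λ b ω′ → run r (suc t) (assign s t (decide t s b)) ω′)
          (subst (λ m → take m (blk ++ ω) ≡ blk) |blk| (take-length-++ blk ω))
          (subst (λ m → drop m (blk ++ ω) ≡ ω) |blk| (drop-length-++ blk ω))

  decide-++ : ∀ {t s f} p → length f ≡ d → decide t s (f ++ [ p ]) ≡ decideWith t s (drop (length (earlier t)) f) p
  decide-++ {f = f} p |f|≡d rewrite sym |f|≡d | take-length-++ f [ p ] | drop-length-++ f [ p ] = refl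

  decide-steered : ∀ {t s} f bs p → length f ≡ length (earlier t) → length f + length bs ≡ d →
                   decide t s (f ++ bs ++ [ p ]) ≡ decideWith t s bs p
  decide-steered {t} {s} f bs p |f| |f|+|bs| = begin
    decide t s (f ++ bs ++ [ p ])                          ≡⟨ cong (decide t s) (sym (++-assoc f bs [ p ])) ⟩
    decide t s ((f ++ bs) ++ [ p ])                        ≡⟨ decide-++ {t} {s} p (trans (length-++ f) |f|+|bs|) ⟩
    decideWith t s (drop (length (earlier t)) (f ++ bs)) p ≡⟨ cong (λ nav → decideWith t s nav p) drop-f ⟩
    decideWith t s bs p                                    ∎
    where
    open ≡-Reasoning
    drop-f : drop (length (earlier t)) (f ++ bs) ≡ bs
    drop-f = subst (λ k → drop k (f ++ bs) ≡ bs) |f| (drop-length-++ f bs)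

  ∈-available⁻ : ∀ {y t s} → y ∈ available t s → y ∈ L t × y ∉ used t s
  ∈-available⁻ {t = t} {s} = ∈-filter⁻ (_∉? used t s) {xs = L t}

  available-length : ∀ {t} s → t < n → 2 ≤ length (available t s)
  available-length {t} s t<n = +-cancelʳ-≤ (length (used t s)) 2 (length (available t s)) (begin
    2 + length (used t s)                      ≡⟨ cong (2 +_) (length-map (colour ∘ s) (earlier t)) ⟩
    2 + length (earlier t)                     ≤⟨ +-monoʳ-≤ 2 (degenerate t<n) ⟩
    2 + d                                      ≡⟨ sym (L-length t<n) ⟩
    length (L t)                               ≤⟨ unique-⊆⇒length≤ _≟_ (L-unique t<n) L⊆available++used ⟩
    length (available t s ++ used t s)         ≡⟨ length-++ (available t s) ⟩
    length (available t s) + length (used t s) ∎)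
    where
    open ≤-Reasoning
    L⊆available++used : L t ⊆ available t s ++ used t s
    L⊆available++used {y} y∈L with y ∈? used t s
    ... | yes y∈used = ∈-++⁺ʳ (available t s) y∈used
    ... | no  y∉used = ∈-++⁺ˡ (∈-filter⁺ (_∉? used t s) y∈L y∉used)

  offerFor-spec : ∀ {t} s nav → t < n → TwoDistinctIn (available t s) (offerFor t s nav)
  offerFor-spec {t} s nav t<n =
    offer-⊆ {T = finalists t s nav}
            (λ y∈ → proj₂ (∈-filter⁻ (_∈? available t s) {xs = shrinkAll nav (candidates t s)} y∈))
            (filter⁺ (_∉? used t s) (L-unique t<n))
            (available-length s t<n)

  decide-available : ∀ {t} s blk → t < n → colour (decide t s blk) ∈ available t s
  decide-available {t} s blk t<n with colour-offered (decide t s blk) | offerFor-spec s (drop (length (earlier t)) (take d blk)) t<n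
  ... | inj₁ c≡a | a∈ , _ , _ = subst (_∈ available t s) (sym c≡a) a∈
  ... | inj₂ c≡b | _ , b∈ , _ = subst (_∈ available t s) (sym c≡b) b∈

  Agree : ℕ → State → State → Set
  Agree t s′ s = ∀ {q} → q < t → s′ q ≡ s q

  assign-≡ : ∀ s t c → assign s t c t ≡ c
  assign-≡ s t c with t ≟ t
  ... | yes _   = refl
  ... | no  t≢t = contradiction refl t≢t

  assign-agrees : ∀ s {t} c → Agree t (assign s t c) s
  assign-agrees s {t} c {q} q<t with q ≟ t
  ... | yes q≡t = contradiction q≡t (<⇒≢ q<t)
  ... | no  _   = refl

  run-agrees : ∀ r {t} s ω → Agree t (run r t s ω) s
  run-agrees zero    s ω q<t = refl
  run-agrees (suc r) s ω q<t = trans (run-agrees r _ _ (m<n⇒m<1+n q<t)) (assign-agrees s _ q<t)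

  map-agree : ∀ {t s′ s} {B : Set} (f : Choice → B) {qs} → Agree t s′ s → All (_< t) qs → map (f ∘ s′) qs ≡ map (f ∘ s) qs
  map-agree f s′≈s qs<t = map-cong-local (All.map (cong f ∘ s′≈s) qs<t)

  available-agree : ∀ {t s′ s} → Agree t s′ s → available t s′ ≡ available t s
  available-agree {t} s′≈s = cong (λ u → filter (_∉? u) (L t)) (map-agree colour s′≈s (filter-upTo-< (t ∼?_) t))

  Proper : ℕ → State → Set
  Proper t s = ∀ {q} → q < t → colour (s q) ∈ available q s

  proper-assign : ∀ {t s} blk → t < n → Proper t s → Proper (suc t) (assign s t (decide t s blk))
  proper-assign {t} {s} blk t<n proper {q} q<1+t with m<1+n⇒m<n∨m≡n q<1+t
  ... | inj₁ q<t  = subst₂ _∈_ (sym (cong colour (assign-agrees s _ q<t)))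
                              (sym (available-agree (λ q′<q → assign-agrees s _ (<-trans q′<q q<t))))
                              (proper q<t)
  ... | inj₂ refl = subst₂ _∈_ (sym (cong colour (assign-≡ s t _)))
                              (sym (available-agree (assign-agrees s _)))
                              (decide-available s blk t<n)

  run-proper : ∀ r {t s} ω → t + r ≡ n → Proper t s → Proper n (run r t s ω)
  run-proper zero    {t} {s} ω t+0≡n proper = subst (λ m → Proper m s) (trans (sym (+-identityʳ t)) t+0≡n) proper
  run-proper (suc r) {t} ω t+r≡n proper =
    run-proper r (drop (suc d) ω) (trans (sym (+-suc t r)) t+r≡n)
               (proper-assign (take (suc d) ω) (subst (t <_) t+r≡n (m<m+n t (s≤s z≤n))) proper)

  colouring : List Bool → ℕ → ℕ
  colouring ω t = colour (run n 0 blank ω t)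

  colouring-proper : ∀ ω {t} → t < n → colouring ω t ∈ L t × (∀ {q} → q < t → t ∼ q → colouring ω t ≢ colouring ω q)
  colouring-proper ω {t} t<n = c∈L , λ q<t t∼q c≡ →
    c∉used (subst (_∈ used t s) (sym c≡) (∈-map⁺ (colour ∘ s) (∈-filter⁺ (t ∼?_) (∈-upTo⁺ q<t) t∼q)))
    where
    s = run n 0 blank ω
    c∈available : colouring ω t ∈ available t s
    c∈available = run-proper n ω refl (λ ()) t<n
    c∈L = proj₁ (∈-available⁻ {s = s} c∈available)
    c∉used = proj₂ (∈-available⁻ {s = s} c∈available)

  module _ {t₀ x} (t₀<n : t₀ < n) (x∈L : x ∈ L t₀) where

    k : ℕ
    k = length (earlier t₀)

    k≤d : k ≤ d
    k≤d = degenerate t₀<n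

    neighboursBefore : ℕ → List ℕ
    neighboursBefore t = filter (t₀ ∼?_) (upTo t)

    ReachableVia : List ℕ → State → Set
    ReachableVia qs s = x ∈ narrowAll (L t₀) (map s qs) × All (λ q → colour (s q) ≢ x) qs

    Reachable : ℕ → State → Set
    Reachable t = ReachableVia (neighboursBefore t)

    neighboursBefore-suc : ∀ t → neighboursBefore (suc t) ≡ neighboursBefore t ++ filter (t₀ ∼?_) [ t ]
    neighboursBefore-suc t = trans (cong (filter (t₀ ∼?_)) (sym (upTo-∷ʳ t))) (filter-++ (t₀ ∼?_) (upTo t) [ t ])

    neighboursBefore-suc-∼ : ∀ {t} → t₀ ∼ t → neighboursBefore (suc t) ≡ neighboursBefore t ++ [ t ]
    neighboursBefore-suc-∼ {t} t₀∼t =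
      trans (neighboursBefore-suc t) (cong (neighboursBefore t ++_) (filter-accept (t₀ ∼?_) t₀∼t))

    neighboursBefore-suc-≁ : ∀ {t} → ¬ t₀ ∼ t → neighboursBefore (suc t) ≡ neighboursBefore t
    neighboursBefore-suc-≁ {t} t₀≁t =
      trans (neighboursBefore-suc t) (trans (cong (neighboursBefore t ++_) (filter-reject (t₀ ∼?_) t₀≁t)) (++-identityʳ _))

    length-neighboursBefore-suc-∼ : ∀ {t} → t₀ ∼ t → length (neighboursBefore (suc t)) ≡ suc (length (neighboursBefore t))
    length-neighboursBefore-suc-∼ {t} t₀∼t =
      trans (cong length (neighboursBefore-suc-∼ t₀∼t)) (trans (length-++ (neighboursBefore t)) (+-comm _ 1))

    length-neighboursBefore-mono : ∀ {t} u → t ≤ u → length (neighboursBefore t) ≤ length (neighboursBefore u)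
    length-neighboursBefore-mono zero    z≤n   = ≤-refl
    length-neighboursBefore-mono (suc u) t≤1+u with m≤n⇒m<n∨m≡n t≤1+u
    ... | inj₂ refl  = ≤-refl
    ... | inj₁ t<1+u = ≤-trans (length-neighboursBefore-mono u (m<1+n⇒m≤n t<1+u)) (≤-trans (m≤m+n _ _) (≤-reflexive
                         (trans (sym (length-++ (neighboursBefore u))) (cong length (sym (neighboursBefore-suc u))))))

    ReachableVia-agree : ∀ {t s′ s qs} → Agree t s′ s → All (_< t) qs → ReachableVia qs s → ReachableVia qs s′
    ReachableVia-agree {qs = qs} s′≈s qs<t (x∈T , colours≢x) =
      subst (λ cs → x ∈ narrowAll (L t₀) cs) (sym (map-agree (λ c → c) s′≈s qs<t)) x∈T ,
      All.zipWith (λ (q<t , c≢x) → subst (_≢ x) (sym (cong colour (s′≈s q<t))) c≢x) (qs<t , colours≢x)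

    Reachable-skip : ∀ {t s} c → ¬ t₀ ∼ t → Reachable t s → Reachable (suc t) (assign s t c)
    Reachable-skip {t} {s} c t₀≁t reach = subst (λ qs → ReachableVia qs (assign s t c)) (sym (neighboursBefore-suc-≁ t₀≁t))
                                                (ReachableVia-agree (assign-agrees s c) (filter-upTo-< _ t) reach)

    Reachable-neighbour : ∀ {t s} c → t₀ ∼ t → Reachable t s → x ∈ narrow (narrowAll (L t₀) (map s (neighboursBefore t))) c →
                          colour c ≢ x → Reachable (suc t) (assign s t c)
    Reachable-neighbour {t} {s} c t₀∼t reach x∈T c≢x =
      subst (λ qs → ReachableVia qs s′) (sym (neighboursBefore-suc-∼ t₀∼t)) (x∈T′ , ++⁺ old (new ∷ []))
      where
      s′ = assign s t c
      old : All (λ q → colour (s′ q) ≢ x) (neighboursBefore t)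
      old = proj₂ (ReachableVia-agree (assign-agrees s c) (filter-upTo-< _ t) reach)
      new : colour (s′ t) ≢ x
      new = subst (λ c′ → colour c′ ≢ x) (sym (assign-≡ s t c)) c≢x
      x∈T′ : x ∈ narrowAll (L t₀) (map s′ (neighboursBefore t ++ [ t ]))
      x∈T′ = subst (x ∈_) (sym (begin
        narrowAll (L t₀) (map s′ (qs ++ [ t ]))    ≡⟨ cong (narrowAll (L t₀)) (map-++ s′ qs [ t ]) ⟩
        narrowAll (L t₀) (map s′ qs ++ [ s′ t ])   ≡⟨ foldl-++ narrow (L t₀) (map s′ qs) [ s′ t ] ⟩
        narrow (narrowAll (L t₀) (map s′ qs)) (s′ t) ≡⟨ cong₂ narrow (cong (narrowAll (L t₀)) agree) (assign-≡ s t c) ⟩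
        narrow (narrowAll (L t₀) (map s qs)) c     ∎)) x∈T
        where
        open ≡-Reasoning
        qs = neighboursBefore t
        agree = map-agree (λ c′ → c′) (assign-agrees s c) (filter-upTo-< _ t)

    forced-at-neighbour : ∀ {t s} → t < n → t₀ ∼ t → Reachable t s →
                          Forced (λ blk → Reachable (suc t) (assign s t (decide t s blk))) (suc d) 1
    forced-at-neighbour {t} {s} t<n t₀∼t reach = subst (λ m → Forced P m 1) (+-comm d 1) (Forced-free d block)
      where
      P : List Bool → Set
      P blk = Reachable (suc t) (assign s t (decide t s blk))
      T = narrowAll (L t₀) (map s (neighboursBefore t))
      block : ∀ {f} → length f ≡ d → Forced (P ∘ (f ++_)) 1 1
      block {f} |f|≡d = choose p (done (subst (λ c → Reachable (suc t) (assign s t c)) (sym (decide-++ {t} {s} p |f|≡d))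
                                              (Reachable-neighbour c t₀∼t reach x∈T′ c≢x)))
        where
        nav = drop (length (earlier t)) f
        cover : ∃[ p ] x ∈ narrow T (decideWith t s nav p)
        cover = narrow-covers (proj₁ reach) (proj₂ (proj₂ (offerFor-spec s nav t<n)))
        p = proj₁ cover
        c = decideWith t s nav p
        x∈T′ = proj₂ cover
        c≢x : colour c ≢ x
        c≢x c≡x = narrow-excludes T c (subst (_∈ narrow T c) (sym c≡x) x∈T′)

    forced-at-target : ∀ {s} → Reachable t₀ s → Forced (λ blk → colour (decide t₀ s blk) ≡ x) (suc d) (suc (d ∸ k))
    forced-at-target {s} (x∈T , colours≢x) = subst₂ (Forced P) |f++g| |g| (Forced-free k block)
      where
      P : List Bool → Set
      P blk = colour (decide t₀ s blk) ≡ x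
      T = candidates t₀ s
      A = available t₀ s
      x∈A : x ∈ A
      x∈A = ∈-filter⁺ (_∉? used t₀ s) x∈L x∉used
        where
        x∉used : x ∉ used t₀ s
        x∉used x∈used with ∈-map⁻ (colour ∘ s) x∈used
        ... | q , q∈ , x≡ = All.lookup colours≢x q∈ (sym x≡)
      steer = shrinkAll-covers (d ∸ k) x∈T
      bs = proj₁ steer
      |bs| : length bs ≡ d ∸ k
      |bs| = proj₁ (proj₂ steer)
      x∈F : x ∈ finalists t₀ s bs
      x∈F = ∈-filter⁺ (_∈? A) (proj₂ (proj₂ steer)) x∈A
      |L| : length (L t₀) ≤ 2 + (length (map s (earlier t₀)) + length bs)
      |L| = ≤-reflexive (trans (L-length t₀<n)
                               (cong (2 +_) (sym (trans (cong₂ _+_ (length-map s (earlier t₀)) |bs|) (m+[n∸m]≡n k≤d)))))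
      |F|≤2 : length (finalists t₀ s bs) ≤ 2
      |F|≤2 = ≤-trans (length-filter (_∈? A) (shrinkAll bs T))
                      (shrinkAll-length bs T (narrowAll-length (L t₀) (map s (earlier t₀)) |L|))
      pick : ∃[ p ] colour (decideWith t₀ s bs p) ≡ x
      pick with offer-covers A x∈F |F|≤2
      ... | inj₁ x≡a = false , sym x≡a
      ... | inj₂ x≡b = true , sym x≡b
      g = bs ++ [ proj₁ pick ]
      |g| : length g ≡ suc (d ∸ k)
      |g| = trans (length-++ bs) (trans (+-comm (length bs) 1) (cong suc |bs|))
      |f++g| : k + length g ≡ suc d
      |f++g| = trans (cong (k +_) |g|) (trans (+-suc k (d ∸ k)) (cong suc (m+[n∸m]≡n k≤d)))
      block : ∀ {f} → length f ≡ k → Forced (P ∘ (f ++_)) (length g) (length g)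
      block {f} |f| = Forced-map (λ ω≡g → subst (P ∘ (f ++_)) (sym ω≡g) hit) (Forced-exactly g)
        where
        hit : P (f ++ g)
        hit = trans (cong colour (decide-steered f bs (proj₁ pick) |f| (trans (cong₂ _+_ |f| |bs|) (m+[n∸m]≡n k≤d)))) (proj₂ pick)

    Forced-run-step : ∀ {r t s blk m c} → length blk ≡ suc d →
                      Forced (λ ω → colour (run r (suc t) (assign s t (decide t s blk)) ω t₀) ≡ x) m c →
                      Forced (λ ω → colour (run (suc r) t s (blk ++ ω) t₀) ≡ x) m c
    Forced-run-step {r} {t} {s} {blk} |blk| =
      Forced-map λ {ω} → subst (λ σ → colour (σ t₀) ≡ x) (sym (run-step {r} {t} {s} {blk} ω |blk|))

    budget-pos : ∀ {t c} → t < t₀ → t₀ ∼ t → length (neighboursBefore t) + c ≡ suc d → ∃[ c′ ] c ≡ suc c′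
    budget-pos {t} {zero} t<t₀ t₀∼t budget = contradiction (≤-trans (n≤1+n _) (begin
      suc (suc d)                       ≡⟨ cong suc (sym (trans (sym (+-identityʳ _)) budget)) ⟩
      suc (length (neighboursBefore t)) ≡⟨ sym (length-neighboursBefore-suc-∼ t₀∼t) ⟩
      length (neighboursBefore (suc t)) ≤⟨ length-neighboursBefore-mono t₀ t<t₀ ⟩
      k                                 ≤⟨ k≤d ⟩
      d                                 ∎)) 1+n≰n
      where open ≤-Reasoning
    budget-pos {c = suc c′} _ _ _ = c′ , refl

    -- c counts the bits still to be fixed: one per neighbour of t₀ coloured at time t or later, and
    -- suc (d ∸ k) at t₀.
    forced-from : ∀ r {t s} c → t ≤ t₀ → t₀ < t + r → length (neighboursBefore t) + c ≡ suc d → Reachable t s →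
                  Forced (λ ω → colour (run r t s ω t₀) ≡ x) (r * suc d) c
    forced-from zero {t} c t≤t₀ t₀<t+0 _ _ = contradiction (subst (t₀ <_) (+-identityʳ t) t₀<t+0) (≤⇒≯ t≤t₀)
    forced-from (suc r) {t} {s} c t≤t₀ t₀<t+1+r budget reach with m≤n⇒m<n∨m≡n t≤t₀
    ... | inj₂ refl = subst (Forced _ (suc d + r * suc d)) cost
                        (Forced-bind (forced-at-target reach) λ {blk} |blk| hit → Forced-run-step {r} {t₀} {s} {blk} |blk|
                          (Forced-always (r * suc d) λ {ω} →
                            trans (cong colour (run-agrees r _ ω (n<1+n t₀))) (trans (cong colour (assign-≡ s t₀ _)) hit)))
      where
      cost : suc (d ∸ k) + 0 ≡ c
      cost = begin
        suc (d ∸ k) + 0 ≡⟨ +-identityʳ _ ⟩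
        suc (d ∸ k)     ≡⟨ sym (+-∸-assoc 1 k≤d) ⟩
        suc d ∸ k       ≡⟨ cong (_∸ k) (sym budget) ⟩
        k + c ∸ k       ≡⟨ m+n∸m≡n k c ⟩
        c               ∎
        where open ≡-Reasoning
    ... | inj₁ t<t₀ with t₀ ∼? t
    ...   | no t₀≁t = Forced-bind (Forced-always (suc d) λ {blk} → Reachable-skip (decide t s blk) t₀≁t reach) λ {blk} |blk| reach′ →
                        Forced-run-step {r} {t} {s} {blk} |blk|
                          (forced-from r c t<t₀ (subst (t₀ <_) (+-suc t r) t₀<t+1+r)
                                       (trans (cong (λ qs → length qs + c) (neighboursBefore-suc-≁ t₀≁t)) budget) reach′)
    ...   | yes t₀∼t with budget-pos t<t₀ t₀∼t budget
    ...     | c′ , refl = Forced-bind (forced-at-neighbour (<-trans t<t₀ t₀<n) t₀∼t reach) λ {blk} |blk| reach′ →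
                            Forced-run-step {r} {t} {s} {blk} |blk|
                              (forced-from r c′ t<t₀ (subst (t₀ <_) (+-suc t r) t₀<t+1+r)
                                           (trans (cong (_+ c′) (length-neighboursBefore-suc-∼ t₀∼t))
                                                  (trans (sym (+-suc _ c′)) budget)) reach′)

    colouring-forced : Forced (λ ω → colouring ω t₀ ≡ x) (n * suc d) (suc d)
    colouring-forced = forced-from n (suc d) z≤n t₀<n refl (x∈L , [])

-- Time t colours the vertex σ (n − 1 − t), so the neighbours coloured before a vertex are among
-- those after it in the degeneracy order.
module TimeOrder (d : ℕ) (G : Graph) (D : Degenerate d G) where

  σ = proj₁ D

  vertexAt : ∀ {t} → t < n G → Fin (n G)
  vertexAt t<n = σ ⟨$⟩ʳ opposite (fromℕ< t<n)

  time : Fin (n G) → ℕ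
  time v = toℕ (opposite (σ ⟨$⟩ˡ v))

  time<n : ∀ v → time v < n G
  time<n v = toℕ<n (opposite (σ ⟨$⟩ˡ v))

  vertexAt-time : ∀ v {t<n : time v < n G} → vertexAt t<n ≡ v
  vertexAt-time v = trans (cong (λ i → σ ⟨$⟩ʳ opposite i) (fromℕ<-toℕ _ _))
                          (trans (cong (σ ⟨$⟩ʳ_) (opposite-involutive _)) (inverseʳ σ))

  time-injective : ∀ {u v} → time u ≡ time v → u ≡ v
  time-injective {u} {v} eq = begin
    u                                     ≡⟨ sym (inverseʳ σ) ⟩
    σ ⟨$⟩ʳ (σ ⟨$⟩ˡ u)                       ≡⟨ cong (σ ⟨$⟩ʳ_) (sym (opposite-involutive _)) ⟩
    σ ⟨$⟩ʳ opposite (opposite (σ ⟨$⟩ˡ u))   ≡⟨ cong (λ i → σ ⟨$⟩ʳ opposite i) (toℕ-injective eq) ⟩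
    σ ⟨$⟩ʳ opposite (opposite (σ ⟨$⟩ˡ v))   ≡⟨ cong (σ ⟨$⟩ʳ_) (opposite-involutive _) ⟩
    σ ⟨$⟩ʳ (σ ⟨$⟩ˡ v)                       ≡⟨ inverseʳ σ ⟩
    v                                     ∎
    where open ≡-Reasoning

  adjAt : ℕ → ℕ → Bool
  adjAt t q with t <? n G | q <? n G
  ... | yes t<n | yes q<n = adj G (vertexAt t<n) (vertexAt q<n)
  ... | _       | _       = false

  adjAt-vertexAt : ∀ {t q} (t<n : t < n G) (q<n : q < n G) → adjAt t q ≡ adj G (vertexAt t<n) (vertexAt q<n)
  adjAt-vertexAt {t} {q} t<n q<n with t <? n G | q <? n G
  ... | yes _   | yes _   = refl
  ... | no  t≮n | _       = contradiction t<n t≮n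
  ... | yes _   | no  q≮n = contradiction q<n q≮n

  adjAt-time : ∀ u v → adjAt (time u) (time v) ≡ adj G u v
  adjAt-time u v = trans (adjAt-vertexAt (time<n u) (time<n v)) (cong₂ (adj G) (vertexAt-time u {time<n u}) (vertexAt-time v {time<n v}))

  _∼_ : ℕ → ℕ → Set
  t ∼ q = adjAt t q ≡ true

  _∼?_ : Decidable _∼_
  t ∼? q = adjAt t q ≟ᴮ true

  earlier-length : ∀ {t} → t < n G → length (filter (t ∼?_) (upTo t)) ≤ d
  earlier-length {t} t<n = begin
    length (filter (t ∼?_) (upTo t))                             ≤⟨ unique-⊆⇒length≤ _≟_ (filter⁺ _ (upTo⁺ t)) earlier⊆ ⟩
    length (map (toℕ ∘ opposite) (filter later? (allFin (n G)))) ≡⟨ length-map (toℕ ∘ opposite) (filter later? (allFin (n G))) ⟩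
    length (filter later? (allFin (n G)))                        ≡⟨ sym (countTrue-map later (allFin (n G))) ⟩
    countTrue (map later (allFin (n G)))                         ≤⟨ proj₂ D i ⟩
    d                                                            ∎
    where
    open ≤-Reasoning
    i = opposite (fromℕ< t<n)
    later : Fin (n G) → Bool
    later j = if ⌊ i F.<? j ⌋ then adj G (σ ⟨$⟩ʳ i) (σ ⟨$⟩ʳ j) else false
    later? = λ j → later j ≟ᴮ true
    earlier⊆ : filter (t ∼?_) (upTo t) ⊆ map (toℕ ∘ opposite) (filter later? (allFin (n G)))
    earlier⊆ {q} q∈ = subst (_∈ _) q≡ (∈-map⁺ (toℕ ∘ opposite) (∈-filter⁺ later? (∈-allFin j) later-j))
      where
      q<t = ∈-upTo⁻ (proj₁ (∈-filter⁻ (t ∼?_) {xs = upTo t} q∈))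
      q<n = <-trans q<t t<n
      j = opposite (fromℕ< q<n)
      q≡ : toℕ (opposite j) ≡ q
      q≡ = trans (cong toℕ (opposite-involutive _)) (toℕ-fromℕ< q<n)
      i<j : i F.< j
      i<j = subst₂ _<_ (sym (trans (opposite-prop (fromℕ< t<n)) (cong (λ m → n G ∸ suc m) (toℕ-fromℕ< t<n))))
                       (sym (trans (opposite-prop (fromℕ< q<n)) (cong (λ m → n G ∸ suc m) (toℕ-fromℕ< q<n))))
                       (∸-monoʳ-< (s≤s q<t) t<n)
      later-j : later j ≡ true
      later-j with i F.<? j
      ... | yes _   = trans (sym (adjAt-vertexAt t<n q<n)) (proj₂ (∈-filter⁻ (t ∼?_) {xs = upTo t} q∈))
      ... | no  i≮j = contradiction i<j i≮j

module DegenerateListColouring (d : ℕ) (G : Graph) (D : Degenerate d G) (LA : ListAssignment (2 + d) G) where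

  open TimeOrder d G D

  L : Fin (n G) → List ℕ
  L = proj₁ LA

  -- Times beyond n G, which are never coloured, get the empty list.
  listAt : ℕ → List ℕ
  listAt t with t <? n G
  ... | yes t<n = L (vertexAt t<n)
  ... | no  _   = []

  listAt-vertexAt : ∀ {t} (t<n : t < n G) → listAt t ≡ L (vertexAt t<n)
  listAt-vertexAt {t} t<n with t <? n G
  ... | yes _   = refl
  ... | no  t≮n = contradiction t<n t≮n

  listAt-time : ∀ v → listAt (time v) ≡ L v
  listAt-time v = trans (listAt-vertexAt (time<n v)) (cong L (vertexAt-time v {time<n v}))

  listAt-unique : ∀ {t} → t < n G → Unique (listAt t)
  listAt-unique t<n = subst Unique (sym (listAt-vertexAt t<n)) (proj₁ (proj₂ LA (vertexAt t<n)))

  listAt-length : ∀ {t} → t < n G → length (listAt t) ≡ 2 + d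
  listAt-length t<n = trans (cong length (listAt-vertexAt t<n)) (proj₂ (proj₂ LA (vertexAt t<n)))

  open GreedyColouring d (n G) _∼?_ listAt listAt-unique listAt-length earlier-length

  colouringOf : List Bool → ProperLColouring G L
  colouringOf ω = (λ v → colouring ω (time v)) , valid , proper
    where
    valid : ∀ v → colouring ω (time v) ∈ L v
    valid v = subst (colouring ω (time v) ∈_) (listAt-time v) (proj₁ (colouring-proper ω (time<n v)))
    proper : ∀ u v → adj G u v ≡ true → colouring ω (time u) ≢ colouring ω (time v)
    proper u v uv with <-cmp (time u) (time v)
    ... | tri< tu<tv _ _ = λ eq → proj₂ (colouring-proper ω (time<n v)) tu<tv
                                         (trans (adjAt-time v u) (trans (Graph.sym G v u) uv)) (sym eq)
    ... | tri> _ _ tv<tu = proj₂ (colouring-proper ω (time<n u)) tv<tu (trans (adjAt-time u v) uv)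
    ... | tri≈ _ tu≡tv _ with time-injective tu≡tv
    ...   | refl with trans (sym uv) (irrefl G u)
    ...     | ()

  colouringOf-forced : ∀ v x → x ∈ L v → Forced (λ ω → proj₁ (colouringOf ω) v ≡ x) (n G * suc d) (suc d)
  colouringOf-forced v x x∈L = colouring-forced (time<n v) (subst (x ∈_) (sym (listAt-time v)) x∈L)

theorem2p7 : (d : ℕ) (G : Graph) → Degenerate d G →
    WeightedFlexiblyChoosable (halfPow (suc d)) (suc (suc d)) G
theorem2p7 d G D LA =
  uniform m colouringOf , (uniform-nonNeg m colouringOf , totalWeight-uniform m colouringOf) ,
  λ v x x∈L → forced⇒prob G L colouringOf v x (colouringOf-forced v x x∈L)
  where
  open DegenerateListColouring d G D LA
  m = n G * suc d
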